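{- Let $n,t,\lambda,s_1,s_2$ be positive integers with $\min\{s_1+1,s_2+1\}\le\lambda\le s_1+s_2$. Then \[m(n,t,\lambda;s_1+1,s_2+1)\ge\max\left\{\binom{n}{t}-\binom{n-\lceil\lambda/s_1\rceil+1}{t},\ \binom{n}{t}-\binom{n-\lceil\lambda/s_2\rceil+1}{n-t}\right\}.\]
   Context: $[m]=\{1,\dots,m\}$. A sequence $A_1,\dots,A_\lambda$ of subsets of $[n]$ (repetitions allowed) is $(k_1,k_2)$-disjoint if $\bigcap_{i\in B}A_i=\emptyset$ for every $k_1$-subset $B\subseteq[\lambda]$ and $\bigcup_{i\in B}A_i=[n]$ for every $k_2$-subset $B\subseteq[\lambda]$ (each condition vacuous if the subset size exceeds $\lambda$). $m(n,t,\lambda;k_1,k_2)$ is the maximum size of a family $\mathcal{F}$ of $t$-subsets of $[n]$ such that no $A_1,\dots,A_\lambda\in\mathcal{F}$ (not necessarily distinct) form a $(k_1,k_2)$-disjoint sequence. -}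

module Defs where

open import Data.Nat using (ℕ; zero; suc; _+_; _∸_; _≤_; _⊔_)
open import Data.Nat.DivMod using (_/_)
open import Data.Nat.Combinatorics using (_C_)
open import Data.Fin using (Fin)
open import Data.Fin.Subset using (Subset; _∈_; _∉_; ∣_∣)
open import Data.List using (List; length)
open import Data.List.Relation.Unary.Unique.Propositional using (Unique)
import Data.List.Membership.Propositional as LM
open import Data.Product using (Σ; ∃; _×_)
open import Relation.Binary.PropositionalEquality using (_≡_)
open import Relation.Nullary using (¬_)

-- ceiling division ⌈a/s⌉ (s = 0 never used: s is assumed positive)
⌈_/_⌉ : ℕ → ℕ → ℕ
⌈ a / zero ⌉ = 0
⌈ a / suc k ⌉ = (a + k) / suc k

IsDisjointSeq : (n λ' k₁ k₂ : ℕ) → (Fin λ' → Subset n) → Set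
IsDisjointSeq n λ' k₁ k₂ A =
  (∀ (B : Subset λ') → ∣ B ∣ ≡ k₁ → ∀ (x : Fin n) → ∃ λ i → i ∈ B × x ∉ A i)
  × (∀ (B : Subset λ') → ∣ B ∣ ≡ k₂ → ∀ (x : Fin n) → ∃ λ i → i ∈ B × x ∈ A i)

Admissible : (n t λ' k₁ k₂ : ℕ) → List (Subset n) → Set
Admissible n t λ' k₁ k₂ F =
  Unique F
  × (∀ {S} → S LM.∈ F → ∣ S ∣ ≡ t)
  × (∀ (A : Fin λ' → Subset n) → (∀ i → A i LM.∈ F) → ¬ IsDisjointSeq n λ' k₁ k₂ A)

-- m(n,t,λ;k₁,k₂) ≥ b  (m is the maximum size of an admissible family)
m≥ : (n t λ' k₁ k₂ b : ℕ) → Set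
m≥ n t λ' k₁ k₂ b = Σ (List (Subset n)) λ F → Admissible n t λ' k₁ k₂ F × b ≤ length F

{-# OPTIONS --safe #-}
module Submission where

-- Let q = ⌈λ/s⌉ − 1, so that q s < λ. If every member of 𝓕 meets [q], assign to each set
-- of a λ-sequence from 𝓕 a point of [q] that it contains; by pigeonhole some point is
-- assigned to s + 1 of the sets, which then have a common point. With s = s₁ this makes
-- the C(n,t) − C(n−q,t) t-subsets meeting [q] admissible. Complementation swaps the two
-- conditions of (k₁,k₂)-disjointness, so with s = s₂ the complements of the (n−t)-subsets
-- meeting [q], i.e. the t-subsets missing a point of [q], give the second bound.

open import Defs
open import Data.Nat using (ℕ; zero; suc; _+_; _∸_; _*_; _≤_; _<_; _⊔_; z≤n; s≤s; _≤?_)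
open import Data.Nat.Properties
  using (+-suc; +-assoc; +-comm; +-monoʳ-≤; ≤-trans; ≤-<-trans; ≤-reflexive; <⇒≱; ≰⇒>;
         m≤n+m; m+n∸n≡m; m∸[m∸n]≡n; 0∸n≡0; ⊔-sel; +-0-monoid)
open import Data.Nat.DivMod using (_/_; m/n*n≤m; m/n≡1+[m∸n]/n)
open import Data.Nat.Combinatorics using (_C_; nCk≡nC[n∸k]; k>n⇒nCk≡0; nCk+nC[k+1]≡[n+1]C[k+1])
open import Algebra.Properties.Monoid.Sum +-0-monoid using (sum)
import Algebra.Lattice.Properties.BooleanAlgebra as BooleanAlgebraProperties
open import Data.Fin using (Fin; zero; suc; toℕ; _≟_)
open import Data.Fin.Subset using (Subset; _∈_; ∣_∣; ⁅_⁆; ⊥; ∁; inside; outside)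
open import Data.Fin.Subset.Properties
  using (∣⁅x⁆∣≡1; x∈⁅y⁆⇒x≡y; ∣⊥∣≡0; ∣∁p∣≡n∸∣p∣; x∈p⇒x∉∁p; x∉p⇒x∈∁p; ∪-∩-booleanAlgebra)
open import Data.Vec using (_∷_; here; there)
open import Data.Vec.Properties using (∷-injectiveʳ)
open import Data.Vec.Functional using (Vector; updateAt; tail)
open import Data.Vec.Functional.Properties using (updateAt-updates; updateAt-minimal)
open import Data.List using (List; []; _∷_; map; _++_; length)
open import Data.List.Properties using (length-++; length-map)
open import Data.List.Relation.Unary.All as All using (All)
import Data.List.Relation.Unary.All.Properties as All
open import Data.List.Relation.Unary.Unique.Propositional using (Unique)
import Data.List.Relation.Unary.Unique.Propositional.Properties as Unique
import Data.List.Relation.Unary.AllPairs as AllPairs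
import Data.List.Membership.Propositional as List
open import Data.List.Membership.Propositional.Properties using (∈-map⁻)
open import Data.List.Relation.Binary.Disjoint.Propositional using (Disjoint)
open import Data.Product using (∃; ∃₂; _×_; _,_; proj₁; proj₂)
open import Data.Sum using (_⊎_; inj₁; inj₂)
open import Function using (_∘_; const)
open import Relation.Binary.PropositionalEquality
open import Relation.Nullary using (¬_; yes; no; contradiction)

sum-updateAt : ∀ {n} (c : Vector ℕ n) y {k} → c y ≡ suc k → sum c ≡ suc (sum (updateAt c y (const k)))
sum-updateAt c zero c₀≡ rewrite c₀≡ = refl
sum-updateAt c (suc y) cy≡ = trans (cong (c zero +_) (sum-updateAt (tail c) y cy≡)) (+-suc (c zero) _)

-- Hole y has capacity c y. Arbitrary capacities make the induction on the number of
-- pigeons go through: placing pigeon 0 uses up one unit of capacity of hole f 0.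
weighted-pigeonhole : ∀ {l n} (f : Fin l → Fin n) (c : Vector ℕ n) →
  l ≤ sum c ⊎ ∃₂ λ i (B : Subset l) → ∣ B ∣ ≡ suc (c (f i)) × (∀ {j} → j ∈ B → f j ≡ f i)
weighted-pigeonhole {zero} f c = inj₁ z≤n
weighted-pigeonhole {suc l} f c with c (f zero) in c[f₀]≡
... | zero = inj₂ (zero , ⁅ zero ⁆ , trans (∣⁅x⁆∣≡1 {n = suc l} zero) (cong suc (sym c[f₀]≡)) ,
                  cong f ∘ x∈⁅y⁆⇒x≡y zero)
... | suc k with weighted-pigeonhole (f ∘ suc) (updateAt c (f zero) (const k))
...   | inj₁ l≤ = inj₁ (subst (suc l ≤_) (sym (sum-updateAt c (f zero) c[f₀]≡)) (s≤s l≤))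
...   | inj₂ (i , B , ∣B∣≡ , B-const) with f (suc i) ≟ f zero
...     | yes fᵢ≡f₀ =
  inj₂ (suc i , inside ∷ B , cong suc ∣B∣≡c[fᵢ] , λ { here → sym fᵢ≡f₀ ; (there j∈B) → B-const j∈B })
  where
  ∣B∣≡c[fᵢ] : ∣ B ∣ ≡ c (f (suc i))
  ∣B∣≡c[fᵢ] = begin
    ∣ B ∣                                           ≡⟨ ∣B∣≡ ⟩
    suc (updateAt c (f zero) (const k) (f (suc i))) ≡⟨ cong (suc ∘ updateAt c (f zero) (const k)) fᵢ≡f₀ ⟩
    suc (updateAt c (f zero) (const k) (f zero))    ≡⟨ cong suc (updateAt-updates (f zero) c) ⟩
    suc k                                           ≡⟨ c[f₀]≡ ⟨
    c (f zero)                                      ≡⟨ cong c fᵢ≡f₀ ⟨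
    c (f (suc i))                                   ∎
    where open ≡-Reasoning
...     | no fᵢ≢f₀ =
  inj₂ (suc i , outside ∷ B , trans ∣B∣≡ (cong suc (updateAt-minimal _ _ c fᵢ≢f₀)) ,
        λ { (there j∈B) → B-const j∈B })

prefixWeight : ∀ {n} → ℕ → ℕ → Vector ℕ n
prefixWeight (suc q) s zero    = s
prefixWeight (suc q) s (suc y) = prefixWeight q s y
prefixWeight zero    s y       = 0

sum-prefixWeight : ∀ {n} q s → sum (prefixWeight {n} q s) ≤ q * s
sum-prefixWeight {zero}  q       s = z≤n
sum-prefixWeight {suc n} zero    s = sum-prefixWeight {n} zero s
sum-prefixWeight {suc n} (suc q) s = +-monoʳ-≤ s (sum-prefixWeight {n} q s)

prefixWeight-< : ∀ {n q s} (y : Fin n) → toℕ y < q → prefixWeight q s y ≡ s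
prefixWeight-< zero    (s≤s _)   = refl
prefixWeight-< (suc y) (s≤s y<q) = prefixWeight-< y y<q

MeetsPrefix : ∀ {n} → ℕ → Subset n → Set
MeetsPrefix q S = ∃ λ y → toℕ y < q × y ∈ S

meetsPrefix⇒¬disjointSeq : ∀ {n l q s k₂} (A : Fin l → Subset n) → q * s < l →
  (∀ i → MeetsPrefix q (A i)) → ¬ IsDisjointSeq n l (suc s) k₂ A
meetsPrefix⇒¬disjointSeq {n} {q = q} {s} A qs<l meets (noCommonPoint , _)
  with weighted-pigeonhole (proj₁ ∘ meets) (prefixWeight q s)
... | inj₁ l≤ = <⇒≱ qs<l (≤-trans l≤ (sum-prefixWeight {n} q s))
... | inj₂ (i , B , ∣B∣≡ , B-const) with meets i
...   | y , y<q , _ with noCommonPoint B (trans ∣B∣≡ (cong suc (prefixWeight-< y y<q))) y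
...     | j , j∈B , y∉Aⱼ = y∉Aⱼ (subst (_∈ A j) (B-const j∈B) (proj₂ (proj₂ (meets j))))

branch : ∀ {n} → List (Subset n) → List (Subset n) → List (Subset (suc n))
branch X Y = map (inside ∷_) X ++ map (outside ∷_) Y

length-branch : ∀ {n} (X Y : List (Subset n)) → length (branch X Y) ≡ length X + length Y
length-branch X Y =
  trans (length-++ (map (inside ∷_) X)) (cong₂ _+_ (length-map (inside ∷_) X) (length-map (outside ∷_) Y))

Unique-branch⁺ : ∀ {n} {X Y : List (Subset n)} → Unique X → Unique Y → Unique (branch X Y)
Unique-branch⁺ uX uY =
  Unique.++⁺ (Unique.map⁺ ∷-injectiveʳ uX) (Unique.map⁺ ∷-injectiveʳ uY) inside≢outside
  where
  inside≢outside : Disjoint (map (inside ∷_) _) (map (outside ∷_) _)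
  inside≢outside (S∈X , S∈Y) with ∈-map⁻ (inside ∷_) S∈X | ∈-map⁻ (outside ∷_) S∈Y
  ... | _ , _ , refl | _ , _ , ()

All-branch⁺ : ∀ {n} {P : Subset (suc n) → Set} {X Y : List (Subset n)} →
  All (P ∘ (inside ∷_)) X → All (P ∘ (outside ∷_)) Y → All P (branch X Y)
All-branch⁺ pX pY = All.++⁺ (All.map⁺ pX) (All.map⁺ pY)

subsetsOfSize : (n t : ℕ) → List (Subset n)
subsetsOfSize n       zero    = ⊥ ∷ []
subsetsOfSize zero    (suc t) = []
subsetsOfSize (suc n) (suc t) = branch (subsetsOfSize n t) (subsetsOfSize n (suc t))

length-subsetsOfSize : ∀ n t → length (subsetsOfSize n t) ≡ n C t
length-subsetsOfSize n       zero    = refl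
length-subsetsOfSize zero    (suc t) = refl
length-subsetsOfSize (suc n) (suc t) = begin
  length (branch X Y)   ≡⟨ length-branch X Y ⟩
  length X + length Y   ≡⟨ cong₂ _+_ (length-subsetsOfSize n t) (length-subsetsOfSize n (suc t)) ⟩
  n C t + n C suc t     ≡⟨ nCk+nC[k+1]≡[n+1]C[k+1] n t ⟩
  suc n C suc t         ∎
  where
  open ≡-Reasoning
  X = subsetsOfSize n t
  Y = subsetsOfSize n (suc t)

subsetsOfSize-unique : ∀ n t → Unique (subsetsOfSize n t)
subsetsOfSize-unique n       zero    = All.[] AllPairs.∷ AllPairs.[]
subsetsOfSize-unique zero    (suc t) = AllPairs.[]
subsetsOfSize-unique (suc n) (suc t) =
  Unique-branch⁺ (subsetsOfSize-unique n t) (subsetsOfSize-unique n (suc t))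

subsetsOfSize-size : ∀ n t → All (λ S → ∣ S ∣ ≡ t) (subsetsOfSize n t)
subsetsOfSize-size n       zero    = ∣⊥∣≡0 n All.∷ All.[]
subsetsOfSize-size zero    (suc t) = All.[]
subsetsOfSize-size (suc n) (suc t) =
  All-branch⁺ (All.map (cong suc) (subsetsOfSize-size n t)) (subsetsOfSize-size n (suc t))

meetingPrefix : (n q t : ℕ) → List (Subset n)
meetingPrefix (suc n) (suc q) (suc t) = branch (subsetsOfSize n t) (meetingPrefix n q (suc t))
meetingPrefix _       _       _       = []

length-meetingPrefix : ∀ n q t → length (meetingPrefix n q t) + (n ∸ q) C t ≡ n C t
length-meetingPrefix zero    q       t       = cong (_C t) (0∸n≡0 q)
length-meetingPrefix (suc n) zero    t       = refl
length-meetingPrefix (suc n) (suc q) zero    = refl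
length-meetingPrefix (suc n) (suc q) (suc t) = begin
  length (branch X Y) + (n ∸ q) C suc t       ≡⟨ cong (_+ (n ∸ q) C suc t) (length-branch X Y) ⟩
  length X + length Y + (n ∸ q) C suc t       ≡⟨ +-assoc (length X) (length Y) _ ⟩
  length X + (length Y + (n ∸ q) C suc t)     ≡⟨ cong₂ _+_ (length-subsetsOfSize n t)
                                                             (length-meetingPrefix n q (suc t)) ⟩
  n C t + n C suc t                           ≡⟨ nCk+nC[k+1]≡[n+1]C[k+1] n t ⟩
  suc n C suc t                               ∎
  where
  open ≡-Reasoning
  X = subsetsOfSize n t
  Y = meetingPrefix n q (suc t)

meetingPrefix-unique : ∀ n q t → Unique (meetingPrefix n q t)
meetingPrefix-unique zero    q       t       = AllPairs.[]
meetingPrefix-unique (suc n) zero    t       = AllPairs.[]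
meetingPrefix-unique (suc n) (suc q) zero    = AllPairs.[]
meetingPrefix-unique (suc n) (suc q) (suc t) =
  Unique-branch⁺ (subsetsOfSize-unique n t) (meetingPrefix-unique n q (suc t))

meetingPrefix-size : ∀ n q t → All (λ S → ∣ S ∣ ≡ t) (meetingPrefix n q t)
meetingPrefix-size zero    q       t       = All.[]
meetingPrefix-size (suc n) zero    t       = All.[]
meetingPrefix-size (suc n) (suc q) zero    = All.[]
meetingPrefix-size (suc n) (suc q) (suc t) =
  All-branch⁺ (All.map (cong suc) (subsetsOfSize-size n t)) (meetingPrefix-size n q (suc t))

meetingPrefix-meets : ∀ n q t → All (MeetsPrefix q) (meetingPrefix n q t)
meetingPrefix-meets zero    q       t       = All.[]
meetingPrefix-meets (suc n) zero    t       = All.[]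
meetingPrefix-meets (suc n) (suc q) zero    = All.[]
meetingPrefix-meets (suc n) (suc q) (suc t) =
  All-branch⁺ (All.tabulate λ _ → zero , s≤s z≤n , here)
              (All.map (λ { (y , y<q , y∈S) → suc y , s≤s y<q , there y∈S }) (meetingPrefix-meets n q (suc t)))

m≥-meetingPrefix : ∀ n t l s k₂ q → q * s < l → m≥ n t l (suc s) k₂ (n C t ∸ (n ∸ q) C t)
m≥-meetingPrefix n t l s k₂ q qs<l = meetingPrefix n q t , admissible , ≤-reflexive count
  where
  admissible : Admissible n t l (suc s) k₂ (meetingPrefix n q t)
  admissible = meetingPrefix-unique n q t
             , All.lookup (meetingPrefix-size n q t)
             , λ A A∈ → meetsPrefix⇒¬disjointSeq A qs<l (All.lookup (meetingPrefix-meets n q t) ∘ A∈)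
  count : n C t ∸ (n ∸ q) C t ≡ length (meetingPrefix n q t)
  count = trans (cong (_∸ (n ∸ q) C t) (sym (length-meetingPrefix n q t))) (m+n∸n≡m _ ((n ∸ q) C t))

∁-involutive : ∀ {n} (p : Subset n) → ∁ (∁ p) ≡ p
∁-involutive {n} = ¬-involutive
  where open BooleanAlgebraProperties (∪-∩-booleanAlgebra n)

∁-injective : ∀ {n} {p q : Subset n} → ∁ p ≡ ∁ q → p ≡ q
∁-injective {p = p} {q} ∁p≡∁q = trans (sym (∁-involutive p)) (trans (cong ∁ ∁p≡∁q) (∁-involutive q))

∈-map-∁⁻ : ∀ {n} {S : Subset n} {F} → S List.∈ map ∁ F → ∁ S List.∈ F
∈-map-∁⁻ S∈ with ∈-map⁻ ∁ S∈
... | S′ , S′∈F , refl = subst (List._∈ _) (sym (∁-involutive S′)) S′∈F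

∁-disjointSeq : ∀ {n l k₁ k₂} (A : Fin l → Subset n) →
  IsDisjointSeq n l k₁ k₂ A → IsDisjointSeq n l k₂ k₁ (∁ ∘ A)
∁-disjointSeq A (noCommonPoint , covering) =
  (λ B ∣B∣≡ x → let i , i∈B , x∈Aᵢ = covering B ∣B∣≡ x in i , i∈B , x∈p⇒x∉∁p x∈Aᵢ) ,
  (λ B ∣B∣≡ x → let i , i∈B , x∉Aᵢ = noCommonPoint B ∣B∣≡ x in i , i∈B , x∉p⇒x∈∁p x∉Aᵢ)

∁-admissible : ∀ {n t l k₁ k₂ F} → Admissible n t l k₁ k₂ F → Admissible n (n ∸ t) l k₂ k₁ (map ∁ F)
∁-admissible {n} {t} {F = F} (unique , size , noDisjointSeq) =
  Unique.map⁺ ∁-injective unique ,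
  size-∁ ,
  λ A A∈ disjoint → noDisjointSeq (∁ ∘ A) (∈-map-∁⁻ ∘ A∈) (∁-disjointSeq A disjoint)
  where
  size-∁ : ∀ {S} → S List.∈ map ∁ F → ∣ S ∣ ≡ n ∸ t
  size-∁ S∈ with ∈-map⁻ ∁ S∈
  ... | S′ , S′∈F , refl = trans (∣∁p∣≡n∸∣p∣ S′) (cong (n ∸_) (size S′∈F))

[]-admissible : ∀ {n t l k₁ k₂} → 0 < l → Admissible n t l k₁ k₂ []
[]-admissible (s≤s _) = AllPairs.[] , (λ ()) , λ A A∈[] _ → contradiction (A∈[] zero) λ ()

m≥-∁ : ∀ {n t l k₁ k₂ b} → m≥ n t l k₁ k₂ b → m≥ n (n ∸ t) l k₂ k₁ b
m≥-∁ (F , admissible , b≤) =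
  map ∁ F , ∁-admissible admissible , ≤-trans b≤ (≤-reflexive (sym (length-map ∁ F)))

m≥-missingPrefix : ∀ n t l s k₁ q → q * s < l → m≥ n t l k₁ (suc s) (n C t ∸ (n ∸ q) C (n ∸ t))
m≥-missingPrefix n t l s k₁ q qs<l with t ≤? n
... | yes t≤n =
  subst₂ (λ t′ b → m≥ n t′ l k₁ (suc s) b)
         (m∸[m∸n]≡n t≤n) (cong (_∸ (n ∸ q) C (n ∸ t)) (sym (nCk≡nC[n∸k] t≤n)))
         (m≥-∁ (m≥-meetingPrefix n (n ∸ t) l s k₁ q qs<l))
... | no t≰n = [] , []-admissible (≤-<-trans z≤n qs<l) , ≤-reflexive nCt∸X≡0
  where
  nCt∸X≡0 : n C t ∸ (n ∸ q) C (n ∸ t) ≡ 0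
  nCt∸X≡0 = trans (cong (_∸ (n ∸ q) C (n ∸ t)) (k>n⇒nCk≡0 (≰⇒> t≰n))) (0∸n≡0 ((n ∸ q) C (n ∸ t)))

m≥-⊔ : ∀ {n t l k₁ k₂} b₁ b₂ → m≥ n t l k₁ k₂ b₁ → m≥ n t l k₁ k₂ b₂ → m≥ n t l k₁ k₂ (b₁ ⊔ b₂)
m≥-⊔ b₁ b₂ M₁ M₂ with ⊔-sel b₁ b₂
... | inj₁ b₁⊔b₂≡b₁ = subst (m≥ _ _ _ _ _) (sym b₁⊔b₂≡b₁) M₁
... | inj₂ b₁⊔b₂≡b₂ = subst (m≥ _ _ _ _ _) (sym b₁⊔b₂≡b₂) M₂

⌈suc/suc⌉≡suc[/] : ∀ l k → ⌈ suc l / suc k ⌉ ≡ suc (l / suc k)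
⌈suc/suc⌉≡suc[/] l k =
  trans (m/n≡1+[m∸n]/n (s≤s (m≤n+m k l))) (cong (λ m → suc (m / suc k)) (m+n∸n≡m l k))

theorem5p5 : (n t λ' s₁ s₂ : ℕ) → 1 ≤ n → 1 ≤ t → 1 ≤ λ' → 1 ≤ s₁ → 1 ≤ s₂ →
    (suc s₁ ≤ λ' ⊎ suc s₂ ≤ λ') → λ' ≤ s₁ + s₂ →
    m≥ n t λ' (suc s₁) (suc s₂)
      ((n C t ∸ ((n + 1 ∸ ⌈ λ' / s₁ ⌉) C t)) ⊔ (n C t ∸ ((n + 1 ∸ ⌈ λ' / s₂ ⌉) C (n ∸ t))))
theorem5p5 n t (suc l) (suc k₁) (suc k₂) _ _ _ _ _ _ _
  rewrite +-comm n 1 | ⌈suc/suc⌉≡suc[/] l k₁ | ⌈suc/suc⌉≡suc[/] l k₂ =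
  m≥-⊔ _ _ (m≥-meetingPrefix n t (suc l) (suc k₁) _ (l / suc k₁) (s≤s (m/n*n≤m l (suc k₁))))
           (m≥-missingPrefix n t (suc l) (suc k₂) _ (l / suc k₂) (s≤s (m/n*n≤m l (suc k₂))))
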